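{- Let $F\colon \mathbf{Set}\to\mathbf{Set}$ be a functor and let $\langle X,\xi\rangle$ be an $F$-coalgebra. (1) If $R\subseteq X\times X$ is an equivalence relation, then $R$ is a precocongruence between $\langle X,\xi\rangle$ and $\langle X,\xi\rangle$ if and only if $R$ is a congruence on $\langle X,\xi\rangle$. (2) For all $x_1,x_2\in X$: $x_1$ and $x_2$ are behaviourally equivalent (as states of $\langle X,\xi\rangle$ and $\langle X,\xi\rangle$) if and only if $x_1$ and $x_2$ are related by some precocongruence between $\langle X,\xi\rangle$ and $\langle X,\xi\rangle$.
   Context: An $F$-coalgebra is a pair $\langle X,\xi\rangle$ with $\xi\colon X\to F(X)$; a function $f\colon X_1\to X_2$ is an $F$-coalgebra morphism from $\langle X_1,\xi_1\rangle$ to $\langle X_2,\xi_2\rangle$ if $F(f)\circ\xi_1=\xi_2\circ f$. Two states $x_1\in X_1$, $x_2\in X_2$ are behaviourally equivalent if there exist an $F$-coalgebra $\langle Y,\gamma\rangle$ and coalgebra morphisms $f_i\colon\langle X_i,\xi_i\rangle\to\langle Y,\gamma\rangle$ ($i=1,2$) with $f_1(x_1)=f_2(x_2)$. For a relation $R\subseteq X_1\times X_2$ with projections $\pi_i\colon R\to X_i$, its pushout in $\mathbf{Set}$ is $\langle P,p_1,p_2\rangle$ where $P=(X_1+X_2)/\theta$, $\theta$ being the smallest equivalence relation on the disjoint union $X_1+X_2$ containing all pairs $(\iota_1(x_1),\iota_2(x_2))$ with $(x_1,x_2)\in R$ ($\iota_i$ the canonical inclusions), and $p_i=\varepsilon\circ\iota_i$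 with $\varepsilon$ the quotient map. $R$ is a precocongruence between $\langle X_1,\xi_1\rangle$ and $\langle X_2,\xi_2\rangle$ if there is a map $\lambda\colon P\to F(P)$ such that $p_1,p_2$ are $F$-coalgebra morphisms into $\langle P,\lambda\rangle$. An equivalence relation $R$ on $X$ is a congruence on $\langle X,\xi\rangle$ if there is a map $\lambda\colon X/R\to F(X/R)$ such that the quotient map $X\to X/R$ is an $F$-coalgebra morphism from $\langle X,\xi\rangle$ to $\langle X/R,\lambda\rangle$. -}

module Defs where

open import Level using (0ℓ)
open import Data.Empty using (⊥)
open import Data.Sum using (_⊎_; inj₁; inj₂)
open import Data.Product using (Σ; ∃; _×_; _,_)
open import Function using (_∘_; id)
open import Function.Bundles using (_⇔_)
open import Relation.Binary using (Rel; REL; IsEquivalence)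
open import Relation.Binary.PropositionalEquality using (_≡_)
import Relation.Binary.Construct.Closure.Equivalence as EqC

-- An endofunctor on Set. Equality of functions in Set is extensional,
-- so functor laws / congruence are stated pointwise.
record Functor : Set₁ where
  field
    F      : Set → Set
    fmap   : {A B : Set} → (A → B) → F A → F B
    fmap-cong : {A B : Set} {f g : A → B} → (∀ a → f a ≡ g a) → ∀ u → fmap f u ≡ fmap g u
    fmap-id   : {A : Set} → ∀ (u : F A) → fmap id u ≡ u
    fmap-∘    : {A B C : Set} (g : B → C) (f : A → B) → ∀ u → fmap (g ∘ f) u ≡ fmap g (fmap f u)

module _ (Fn : Functor) where
  open Functor Fn

  record Coalgebra : Set₁ where
    constructor ⟨_,_⟩
    field
      Carrier : Set
      str     : Carrier → F Carrier

  open Coalgebra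

  IsMorphism : (C₁ C₂ : Coalgebra) → (Carrier C₁ → Carrier C₂) → Set
  IsMorphism C₁ C₂ f = ∀ x → fmap f (str C₁ x) ≡ str C₂ (f x)

  BehEq : (C₁ C₂ : Coalgebra) → Carrier C₁ → Carrier C₂ → Set₁
  BehEq C₁ C₂ x₁ x₂ =
    Σ Coalgebra λ D →
    Σ (Carrier C₁ → Carrier D) λ f₁ →
    Σ (Carrier C₂ → Carrier D) λ f₂ →
    IsMorphism C₁ D f₁ × IsMorphism C₂ D f₂ × (f₁ x₁ ≡ f₂ x₂)

record Quotient {A : Set} (E : Rel A 0ℓ) : Set₁ where
  field
    Q         : Set
    [_]       : A → Q
    sound     : ∀ {x y} → E x y → [ x ] ≡ [ y ]
    effective : ∀ {x y} → [ x ] ≡ [ y ] → E x y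
    surj      : ∀ q → ∃ λ x → [ x ] ≡ q
    lift      : {B : Set} (f : A → B) → (∀ {x y} → E x y → f x ≡ f y) → Q → B
    lift-β    : {B : Set} (f : A → B) (r : ∀ {x y} → E x y → f x ≡ f y) →
                ∀ x → lift f r [ x ] ≡ f x

Quotients : Set₁
Quotients = (A : Set) (E : Rel A 0ℓ) → IsEquivalence E → Quotient E

PushBase : {X₁ X₂ : Set} → REL X₁ X₂ 0ℓ → Rel (X₁ ⊎ X₂) 0ℓ
PushBase R (inj₁ x₁) (inj₂ x₂) = R x₁ x₂
PushBase R _ _ = ⊥

θ : {X₁ X₂ : Set} → REL X₁ X₂ 0ℓ → Rel (X₁ ⊎ X₂) 0ℓ
θ R = EqC.EqClosure (PushBase R)

module _ (Fn : Functor) (quot : Quotients) where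
  open Functor Fn
  open Coalgebra

  Pushout : (X₁ X₂ : Set) (R : REL X₁ X₂ 0ℓ) → Quotient (θ R)
  Pushout X₁ X₂ R = quot (X₁ ⊎ X₂) (θ R) (EqC.isEquivalence (PushBase R))

  IsPrecocongruence : (C₁ C₂ : Coalgebra Fn) → REL (Carrier C₁) (Carrier C₂) 0ℓ → Set
  IsPrecocongruence C₁ C₂ R =
    Σ (P → F P) λ λ′ →
      IsMorphism Fn C₁ ⟨ P , λ′ ⟩ (ε ∘ inj₁) × IsMorphism Fn C₂ ⟨ P , λ′ ⟩ (ε ∘ inj₂)
    where
      open Quotient (Pushout (Carrier C₁) (Carrier C₂) R) renaming (Q to P; [_] to ε)

  IsCongruence : (C : Coalgebra Fn) (R : Rel (Carrier C) 0ℓ) → IsEquivalence R → Set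
  IsCongruence C R eq =
    Σ (X/R → F X/R) λ λ′ → IsMorphism Fn C ⟨ X/R , λ′ ⟩ q
    where
      open Quotient (quot (Carrier C) R eq) renaming (Q to X/R; [_] to q)

module Submission where

-- For an equivalence relation R on X the pushout of X ← R → X
-- is (isomorphic to) the quotient X/R: the codiagonal X + X → X/R and the
-- map X/R → P induced by the first injection are mutually compatible with
-- the quotient maps.  Both directions of (1) are then instances of a single
-- "transport of structure" lemma: a coalgebra structure on one of the two
-- sets is carried to the other along these maps.
--
-- A precocongruence relating x₁ and x₂ yields behavioural
-- equivalence with the pushout as witness.  Conversely, given morphisms
-- f₁, f₂ into D with f₁ x₁ = f₂ x₂, we coequalise f₁ and f₂ to obtain a
-- single morphism v out of ⟨X, ξ⟩ identifying x₁ and x₂.  The kernel of a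
-- coalgebra morphism is a congruence; this uses a retraction of the
-- injective map X/ker v → Y, which exists because quotients in Set entail
-- excluded middle (Diaconescu).  Part (1) turns this congruence into the
-- required precocongruence.

open import Defs
open import Level using (0ℓ)
open import Data.Bool using (Bool; true; false; _≟_)
open import Data.Empty using (⊥-elim)
open import Data.Product using (Σ; ∃; _×_; _,_; proj₁; proj₂)
open import Data.Sum using (_⊎_; inj₁; inj₂; [_,_]′)
open import Function using (_∘_)
open import Function.Bundles using (_⇔_; mk⇔; Equivalence)
open import Relation.Binary using (Rel; IsEquivalence)
open import Relation.Binary.PropositionalEquality
  using (_≡_; refl; sym; trans; cong; module ≡-Reasoning)
  renaming (isEquivalence to ≡-isEquivalence)
open import Relation.Nullary using (Dec; yes; no)
import Relation.Binary.Construct.Closure.Equivalence as EqC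

-- Quotients in Set decide every proposition P: quotient Bool by
-- "b ≡ c or P"; then P holds exactly when the classes of true and false
-- coincide, which is decidable by comparing their chosen representatives.
module Diaconescu (quot : Quotients) (P : Set) where
  E : Rel Bool 0ℓ
  E b c = (b ≡ c) ⊎ P

  E-isEquivalence : IsEquivalence E
  E-isEquivalence = record
    { refl  = inj₁ refl
    ; sym   = λ { (inj₁ e) → inj₁ (sym e) ; (inj₂ p) → inj₂ p }
    ; trans = λ { (inj₁ e) (inj₁ e′) → inj₁ (trans e e′) ; (inj₂ p) _ → inj₂ p ; _ (inj₂ p) → inj₂ p }
    }

  open Quotient (quot Bool E E-isEquivalence)

  representative : Q → Bool
  representative c = proj₁ (surj c)

  representative-correct : ∀ c → [ representative c ] ≡ c
  representative-correct c = proj₂ (surj c)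

  classes-equal : representative [ true ] ≡ representative [ false ] → [ true ] ≡ [ false ]
  classes-equal e = begin
    [ true ]                            ≡⟨ sym (representative-correct [ true ]) ⟩
    [ representative [ true ] ]         ≡⟨ cong [_] e ⟩
    [ representative [ false ] ]        ≡⟨ representative-correct [ false ] ⟩
    [ false ]                           ∎
    where open ≡-Reasoning

  decide : Dec P
  decide with representative [ true ] ≟ representative [ false ]
  ... | yes e with effective (classes-equal e)
  ...   | inj₁ ()
  ...   | inj₂ p = yes p
  decide | no different = no λ p → different (cong representative (sound (inj₂ p)))

excluded-middle : Quotients → (P : Set) → Dec P
excluded-middle = Diaconescu.decide

kernel : {X Y : Set} → (X → Y) → Rel X 0ℓ
kernel v a b = v a ≡ v b

kernel-isEquivalence : {X Y : Set} {v : X → Y} → IsEquivalence (kernel v)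
kernel-isEquivalence = record { refl = refl ; sym = sym ; trans = trans }

-- Using excluded middle, the injective map X/ker v → Y has a retraction as
-- soon as X/ker v is inhabited: a class c serves as the value off the image.
module _ (quot : Quotients) {X Y : Set} (v : X → Y) (X/K : Quotient (kernel v)) where
  open Quotient X/K

  retraction : Q → Y → Q
  retraction c y with excluded-middle quot (∃ λ x → v x ≡ y)
  ... | yes (x , _) = [ x ]
  ... | no _        = c

  retraction-β : ∀ c x → retraction c (v x) ≡ [ x ]
  retraction-β c x with excluded-middle quot (∃ λ x′ → v x′ ≡ v x)
  ... | yes (x′ , vx′≡vx) = sound vx′≡vx
  ... | no ∄preimage      = ⊥-elim (∄preimage (x , refl))

module _ (Fn : Functor) where
  open Functor Fn
  open Coalgebra

  fmap-triangle : {A B D : Set} (g : B → D) (f : A → B) (k : A → D) →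
    (∀ a → g (f a) ≡ k a) → ∀ u → fmap g (fmap f u) ≡ fmap k u
  fmap-triangle g f k gf≗k u = trans (sym (fmap-∘ g f u)) (fmap-cong gf≗k u)

  ∘-morphism : (C D E : Coalgebra Fn) (f : Carrier C → Carrier D) (g : Carrier D → Carrier E) →
    IsMorphism Fn C D f → IsMorphism Fn D E g → IsMorphism Fn C E (g ∘ f)
  ∘-morphism C D E f g mf mg x = begin
    fmap (g ∘ f) (str C x)       ≡⟨ fmap-∘ g f (str C x) ⟩
    fmap g (fmap f (str C x))    ≡⟨ cong (fmap g) (mf x) ⟩
    fmap g (str D (f x))         ≡⟨ mg (f x) ⟩
    str E (g (f x))              ∎
    where open ≡-Reasoning

  -- The structure on B obtained from α : A → F A along g : B → A and a
  -- family of maps h b : A → B (the family lets h use b as a default point).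
  transported : {A B : Set} → (A → F A) → (B → A) → (B → A → B) → B → F B
  transported α g h b = fmap (h b) (α (g b))

  transport-morphism : (C : Coalgebra Fn) {A B : Set} (α : A → F A)
    (f : Carrier C → A) (k : Carrier C → B) (g : B → A) (h : B → A → B) →
    IsMorphism Fn C ⟨ A , α ⟩ f →
    (∀ x → g (k x) ≡ f x) → (∀ b x → h b (f x) ≡ k x) →
    IsMorphism Fn C ⟨ B , transported α g h ⟩ k
  transport-morphism C α f k g h mf gk≗f hf≗k x = begin
    fmap k (str C x)                   ≡⟨ sym (fmap-triangle (h (k x)) f k (hf≗k (k x)) (str C x)) ⟩
    fmap (h (k x)) (fmap f (str C x))  ≡⟨ cong (fmap (h (k x))) (mf x) ⟩
    fmap (h (k x)) (α (f x))           ≡⟨ cong (fmap (h (k x)) ∘ α) (sym (gk≗f x)) ⟩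
    transported α g h (k x)            ∎
    where open ≡-Reasoning

module _ (Fn : Functor) (quot : Quotients) where
  open Functor Fn
  open Coalgebra

  module DiagonalPushout (X : Set) (R : Rel X 0ℓ) (eq : IsEquivalence R) where
    module P = Quotient (Pushout Fn quot X X R)
    module X/R = Quotient (quot X R eq)
    open IsEquivalence eq using () renaming (refl to R-refl)

    codiagonal : X ⊎ X → X/R.Q
    codiagonal = [ X/R.[_] , X/R.[_] ]′

    codiagonal-respects : ∀ {a b} → PushBase R a b → codiagonal a ≡ codiagonal b
    codiagonal-respects {inj₁ _} {inj₂ _} r = X/R.sound r

    toQuotient : P.Q → X/R.Q
    toQuotient = P.lift codiagonal (EqC.gfold ≡-isEquivalence codiagonal (λ {a} {b} → codiagonal-respects {a} {b}))

    toQuotient-ι : ∀ a → toQuotient P.[ a ] ≡ codiagonal a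
    toQuotient-ι = P.lift-β codiagonal _

    ι₁≡ι₂ : ∀ x → P.[ inj₁ x ] ≡ P.[ inj₂ x ]
    ι₁≡ι₂ x = P.sound (EqC.return (R-refl {x}))

    fromQuotient : X/R.Q → P.Q
    fromQuotient = X/R.lift (P.[_] ∘ inj₁) λ {x} {y} r →
      P.sound (EqC.transitive (PushBase R) (EqC.return r) (EqC.symmetric (PushBase R) (EqC.return (R-refl {y}))))

    fromQuotient-ι₁ : ∀ x → fromQuotient X/R.[ x ] ≡ P.[ inj₁ x ]
    fromQuotient-ι₁ = X/R.lift-β (P.[_] ∘ inj₁) _

    fromQuotient-ι₂ : ∀ x → fromQuotient X/R.[ x ] ≡ P.[ inj₂ x ]
    fromQuotient-ι₂ x = trans (fromQuotient-ι₁ x) (ι₁≡ι₂ x)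

  precocongruence⇔congruence : (C : Coalgebra Fn) (R : Rel (Carrier C) 0ℓ) (eq : IsEquivalence R) →
    IsPrecocongruence Fn quot C C R ⇔ IsCongruence Fn quot C R eq
  precocongruence⇔congruence C R eq = mk⇔ toCongruence toPrecocongruence
    where
      open DiagonalPushout (Carrier C) R eq

      toCongruence : IsPrecocongruence Fn quot C C R → IsCongruence Fn quot C R eq
      toCongruence (λ′ , p₁-morphism , _) =
        transported Fn λ′ fromQuotient (λ _ → toQuotient) ,
        transport-morphism Fn C λ′ (P.[_] ∘ inj₁) X/R.[_] fromQuotient (λ _ → toQuotient)
          p₁-morphism fromQuotient-ι₁ (λ _ → toQuotient-ι ∘ inj₁)

      toPrecocongruence : IsCongruence Fn quot C R eq → IsPrecocongruence Fn quot C C R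
      toPrecocongruence (μ , q-morphism) =
        transported Fn μ toQuotient (λ _ → fromQuotient) ,
        transport-morphism Fn C μ X/R.[_] (P.[_] ∘ inj₁) toQuotient (λ _ → fromQuotient)
          q-morphism (toQuotient-ι ∘ inj₁) (λ _ → fromQuotient-ι₁) ,
        transport-morphism Fn C μ X/R.[_] (P.[_] ∘ inj₂) toQuotient (λ _ → fromQuotient)
          q-morphism (toQuotient-ι ∘ inj₂) (λ _ → fromQuotient-ι₂)

  kernel-congruence : (C D : Coalgebra Fn) (v : Carrier C → Carrier D) → IsMorphism Fn C D v →
    IsCongruence Fn quot C (kernel v) kernel-isEquivalence
  kernel-congruence C D v v-morphism =
    transported Fn (str D) induced (retraction quot v X/K) ,
    transport-morphism Fn C (str D) v X/K.[_] induced (retraction quot v X/K)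
      v-morphism (X/K.lift-β v λ e → e) (retraction-β quot v X/K)
    where
      X/K = quot (Carrier C) (kernel v) kernel-isEquivalence
      module X/K = Quotient X/K

      induced : X/K.Q → Carrier D
      induced = X/K.lift v λ e → e

  coequalizer : (C D : Coalgebra Fn) (f₁ f₂ : Carrier C → Carrier D) →
    IsMorphism Fn C D f₁ → IsMorphism Fn C D f₂ →
    Σ (Coalgebra Fn) λ E → Σ (Carrier D → Carrier E) λ e →
      IsMorphism Fn D E e × (∀ x → e (f₁ x) ≡ e (f₂ x))
  coequalizer C D f₁ f₂ f₁-morphism f₂-morphism =
    ⟨ Q , structure ⟩ , [_] , (λ d → sym (lift-β _ _ d)) , λ x → sound (EqC.return (x , refl , refl))
    where
      Glued : Rel (Carrier D) 0ℓ
      Glued d d′ = ∃ λ x → f₁ x ≡ d × f₂ x ≡ d′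

      open Quotient (quot (Carrier D) (EqC.EqClosure Glued) (EqC.isEquivalence Glued))

      respects-glued : ∀ {d d′} → Glued d d′ → fmap [_] (str D d) ≡ fmap [_] (str D d′)
      respects-glued (x , refl , refl) = begin
        fmap [_] (str D (f₁ x))        ≡⟨ cong (fmap [_]) (sym (f₁-morphism x)) ⟩
        fmap [_] (fmap f₁ (str C x))   ≡⟨ fmap-triangle Fn [_] f₁ ([_] ∘ f₂) glue (str C x) ⟩
        fmap ([_] ∘ f₂) (str C x)      ≡⟨ fmap-∘ [_] f₂ (str C x) ⟩
        fmap [_] (fmap f₂ (str C x))   ≡⟨ cong (fmap [_]) (f₂-morphism x) ⟩
        fmap [_] (str D (f₂ x))        ∎
        where
          open ≡-Reasoning
          glue : ∀ y → [ f₁ y ] ≡ [ f₂ y ]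
          glue y = sound (EqC.return (y , refl , refl))

      structure : Q → F Q
      structure = lift (fmap [_] ∘ str D) (EqC.gfold ≡-isEquivalence _ respects-glued)

  behEq⇔precocongruent : (C : Coalgebra Fn) (x₁ x₂ : Carrier C) →
    BehEq Fn C C x₁ x₂ ⇔ Σ (Rel (Carrier C) 0ℓ) (λ R → IsPrecocongruence Fn quot C C R × R x₁ x₂)
  behEq⇔precocongruent C x₁ x₂ = mk⇔ toPrecocongruent toBehEq
    where
      toBehEq : Σ (Rel (Carrier C) 0ℓ) (λ R → IsPrecocongruence Fn quot C C R × R x₁ x₂) →
        BehEq Fn C C x₁ x₂
      toBehEq (R , (λ′ , p₁-morphism , p₂-morphism) , x₁Rx₂) =
        ⟨ _ , λ′ ⟩ , _ , _ , p₁-morphism , p₂-morphism ,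
        Quotient.sound (Pushout Fn quot (Carrier C) (Carrier C) R) (EqC.return x₁Rx₂)

      toPrecocongruent : BehEq Fn C C x₁ x₂ →
        Σ (Rel (Carrier C) 0ℓ) (λ R → IsPrecocongruence Fn quot C C R × R x₁ x₂)
      toPrecocongruent (D , f₁ , f₂ , f₁-morphism , f₂-morphism , f₁x₁≡f₂x₂)
        with coequalizer C D f₁ f₂ f₁-morphism f₂-morphism
      ... | E , e , e-morphism , e-coequalizes =
        kernel v ,
        Equivalence.from (precocongruence⇔congruence C (kernel v) kernel-isEquivalence)
          (kernel-congruence C E v (∘-morphism Fn C D E f₁ e f₁-morphism e-morphism)) ,
        trans (cong e f₁x₁≡f₂x₂) (sym (e-coequalizes x₂))
        where
          v : Carrier C → Carrier E
          v = e ∘ f₁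

theorem3p12 : (Fn : Functor) (quot : Quotients) (C : Coalgebra Fn) →
    ((R : Rel (Coalgebra.Carrier C) 0ℓ) (eq : IsEquivalence R) →
      IsPrecocongruence Fn quot C C R ⇔ IsCongruence Fn quot C R eq)
    ×
    ((x₁ x₂ : Coalgebra.Carrier C) →
      BehEq Fn C C x₁ x₂ ⇔
      Σ (Rel (Coalgebra.Carrier C) 0ℓ) (λ R → IsPrecocongruence Fn quot C C R × R x₁ x₂))
theorem3p12 Fn quot C = precocongruence⇔congruence Fn quot C , behEq⇔precocongruent Fn quot C
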